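{- Let $(W,S)$ be a finite Coxeter system, let $I_1,\dots,I_r\subseteq S$ and $W_i=W_{I_i}$. Then the $(I_1,I_2\cup\dots\cup I_r;W,S)$-bigraph has a vertex-percolating sequence in the part $W/W_1$; that is, there exist a vertex $v\in W/W_1$ and a finite vertex-folding sequence $J_0,J_1,\dots,J_N$ in this bigraph with $J_0=\{v\}$ and $J_N=W/W_1$.
   Context: A finite Coxeter system $(W,S)$: $W$ is a finite group with generating set $S=\{s_1,\dots,s_m\}$ and presentation $\langle s_1,\dots,s_m \mid (s_is_j)^{m_{ij}}=1\rangle$, $m_{ii}=1$, $m_{ij}=m_{ji}\ge2$ for $i\ne j$; for $I\subseteq S$, $W_I$ is the subgroup generated by $I$. The $(I_1,I_2\cup\dots\cup I_r;W,S)$-bigraph is the simple bipartite graph with parts $W/W_1$ and the disjoint union $(W/W_2)\sqcup\cdots\sqcup(W/W_r)$, in which $wW_1$ is adjacent to $wW_i$ for every $w\in W$ and $2\le i\le r$. A cut involution of a graph $H$ is an automorphism $\phi$ with $\phi^2=\mathrm{id}$ together with a partition $L\cup F\cup R$ of $V(H)$ such that $\phi$ fixes every vertex of $F$, $\phi(L)=R$, and no edge joins $L$ to $R$. Its left-folding map is $\phi^+(v)=\phi(v)$ for $v\in R$ and $\phi^+(v)=v$ otherwise; its right-folding map is $\phi^-(v)=\phi(v)$ for $v\in L$ and $\phi^-(v)=v$ otherwise. For $K\subseteq V(H)$, $K^+(\phi)=\{v:\phi^+(v)\in K\}$ and $K^-(\phi)=\{v:\phi^-(v)\in K\}$. A vertex-folding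 sequence is a sequence $J_0,J_1,\dots$ of vertex subsets such that for each $i$ there is a cut involution $\phi_i$ of $H$ with $J_{i+1}=J_i^+(\phi_i)$ or $J_{i+1}=J_i^-(\phi_i)$. A vertex-percolating sequence in a part is a finite vertex-folding sequence that begins with a single vertex and ends with the entire part containing that vertex. -}

module Defs where

open import Level using (0ℓ)
open import Data.Nat using (ℕ; zero; suc; _≥_)
open import Data.Fin using (Fin)
import Data.Fin as Fin
open import Data.Fin.Subset using (Subset; _∈_) renaming (⊤ to fullSet)
open import Data.Product using (Σ; _×_; _,_; ∃)
open import Data.Sum using (_⊎_)
open import Data.Empty using (⊥)
open import Data.Unit using (⊤)
open import Data.Bool using (true)
open import Data.List using (List)
open import Relation.Nullary using (¬_)
open import Relation.Binary.PropositionalEquality using (_≡_)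
open import Algebra.Bundles using (Group)
open import Algebra.Morphism.Structures using (IsGroupHomomorphism)
open import Function.Bundles using (_⇔_)

module _ (G : Group 0ℓ 0ℓ) where
  open Group G

  pow : Carrier → ℕ → Carrier
  pow x zero    = ε
  pow x (suc n) = x ∙ pow x n

  data InSubgroup {k : ℕ} (s : Fin k → Carrier) (I : Subset k) : Carrier → Set where
    gen  : ∀ {i} → i ∈ I → InSubgroup s I (s i)
    one  : InSubgroup s I ε
    mul  : ∀ {x y} → InSubgroup s I x → InSubgroup s I y → InSubgroup s I (x ∙ y)
    inv  : ∀ {x} → InSubgroup s I x → InSubgroup s I (x ⁻¹)
    resp : ∀ {x y} → x ≈ y → InSubgroup s I x → InSubgroup s I y

-- W is a finite group and (W,S) has the Coxeter presentation
--   < s_i | (s_i s_j)^(m i j) = 1 >,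
-- expressed by: S generates W, the relations hold, and every assignment of
-- the generators into a group satisfying the relations extends to a group
-- homomorphism (unique, since S generates W).

record CoxeterSystem : Set₁ where
  field
    W      : Group 0ℓ 0ℓ
  open Group W public
  field
    k      : ℕ
    m      : Fin k → Fin k → ℕ
    m-diag : ∀ i → m i i ≡ 1
    m-sym  : ∀ i j → m i j ≡ m j i
    m-off  : ∀ i j → ¬ (i ≡ j) → m i j ≥ 2
    s      : Fin k → Carrier
    size       : ℕ
    enum       : Fin size → Carrier
    enum-surj  : ∀ x → ∃ λ a → enum a ≈ x
    enum-inj   : ∀ a b → enum a ≈ enum b → a ≡ b
    generated  : ∀ x → InSubgroup W s fullSet x
    relations  : ∀ i j → pow W (s i ∙ s j) (m i j) ≈ ε
    universal  : (H : Group 0ℓ 0ℓ) (g : Fin k → Group.Carrier H) →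
                 (∀ i j → Group._≈_ H (pow H (Group._∙_ H (g i) (g j)) (m i j)) (Group.ε H)) →
                 Σ (Carrier → Group.Carrier H) λ h →
                   IsGroupHomomorphism rawGroup (Group.rawGroup H) h ×
                   (∀ i → Group._≈_ H (h (s i)) (g i))

-- The (I_1, I_2 ∪ ... ∪ I_r ; W, S)-bigraph, with r = suc r'.
-- I zero is I_1; I (suc j) for j : Fin r' are I_2,...,I_r.
-- Vertices are cosets, represented by a tag and a representative w,
-- with the coset-equality relation _∼_ :
--   left w      represents  w W_1           (part W/W_1)
--   right j w   represents  w W_(j+2)       (copy j of the disjoint union)

module Bigraph (C : CoxeterSystem) (r' : ℕ) (I : Fin (suc r') → Subset (CoxeterSystem.k C)) where
  open CoxeterSystem C

  InW : Fin (suc r') → Carrier → Set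
  InW j = InSubgroup W s (I j)

  data Vertex : Set where
    left  : Carrier → Vertex
    right : Fin r' → Carrier → Vertex

  _∼_ : Vertex → Vertex → Set
  left w    ∼ left w'    = InW Fin.zero (w ⁻¹ ∙ w')
  left _    ∼ right _ _  = ⊥
  right _ _ ∼ left _     = ⊥
  right i w ∼ right j w' = i ≡ j × InW (Fin.suc i) (w ⁻¹ ∙ w')

  InLeftPart : Vertex → Set
  InLeftPart (left _)    = ⊤
  InLeftPart (right _ _) = ⊥

  -- adjacency: u W_1 is adjacent to u W_i for every u ∈ W
  Adj : Vertex → Vertex → Set
  Adj (left w)    (right j w') = ∃ λ u → InW Fin.zero (w ⁻¹ ∙ u) × InW (Fin.suc j) (w' ⁻¹ ∙ u)
  Adj (right j w') (left w)    = ∃ λ u → InW Fin.zero (w ⁻¹ ∙ u) × InW (Fin.suc j) (w' ⁻¹ ∙ u)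
  Adj (left _)    (left _)     = ⊥
  Adj (right _ _) (right _ _)  = ⊥

  VSet : Set₁
  VSet = Vertex → Set

  Respects : VSet → Set
  Respects P = ∀ {x y} → x ∼ y → P x → P y

  _≐_ : VSet → VSet → Set
  P ≐ Q = ∀ v → (P v → Q v) × (Q v → P v)

  record CutInvolution : Set₁ where
    field
      φ        : Vertex → Vertex
      φ-resp   : ∀ {x y} → x ∼ y → φ x ∼ φ y
      φ-invol  : ∀ v → φ (φ v) ∼ v
      φ-adj    : ∀ x y → (Adj x y → Adj (φ x) (φ y)) × (Adj (φ x) (φ y) → Adj x y)
      L F R    : VSet
      L-resp   : Respects L
      F-resp   : Respects F
      R-resp   : Respects R
      cover    : ∀ v → L v ⊎ (F v ⊎ R v)
      LF-disj  : ∀ v → ¬ (L v × F v)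
      LR-disj  : ∀ v → ¬ (L v × R v)
      FR-disj  : ∀ v → ¬ (F v × R v)
      F-fixed  : ∀ v → F v → φ v ∼ v
      φL⊆R     : ∀ v → L v → R (φ v)
      R⊆φL     : ∀ v → R v → ∃ λ u → L u × φ u ∼ v
      no-LR    : ∀ x y → L x → R y → ¬ Adj x y

    -- φ⁺(v) ∈ K, where φ⁺(v) = φ(v) for v ∈ R and v otherwise
    _⁺ : VSet → VSet
    (K ⁺) v = (R v → K (φ v)) × (¬ R v → K v)

    -- φ⁻(v) ∈ K, where φ⁻(v) = φ(v) for v ∈ L and v otherwise
    _⁻ : VSet → VSet
    (K ⁻) v = (L v → K (φ v)) × (¬ L v → K v)

  data FoldSeq : VSet → VSet → Set₁ where
    stop : ∀ {J J'} → J ≐ J' → FoldSeq J J'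
    step : ∀ {J J₁ J'} (ψ : CutInvolution) →
           (J₁ ≐ CutInvolution._⁺ ψ J ⊎ J₁ ≐ CutInvolution._⁻ ψ J) →
           FoldSeq J₁ J' → FoldSeq J J'

  HasPercolatingSeqLeft : Set₁
  HasPercolatingSeqLeft =
    Σ Vertex λ v → InLeftPart v × FoldSeq (λ x → x ∼ v) InLeftPart

{-# OPTIONS --safe #-}
-- Each simple reflection s gives a cut involution of the bigraph: left multiplication by s either
-- fixes a coset w W_J or moves it across the wall of s, and the side is read off the reflection
-- cocycle N (N w s = true iff ℓ(s w) < ℓ(w)).  N exists because the Coxeter presentation lifts W
-- into W ⋉ 𝒫(W).  Every reflection inverted by an element of W_J lies in W_J, so the side is well
-- defined on cosets, and the two ends w W_1, w W_i of an edge lie on the same side.  Folding along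
-- s never lengthens a coset, and by strong exchange a coset whose shortest element has length
-- n + 1 lies beyond the wall of some s, so one round of folds along all of S shortens it.  After
-- as many rounds as the length of the longest element, the composite folding map sends the whole
-- part W/W_1 onto W_1, so the folding sequence starting from {W_1} ends with W/W_1.
module Submission where

open import Defs
open import Data.Nat using (ℕ; suc)
open import Data.Fin using (Fin)
open import Data.Fin.Subset using (Subset)

open import Level using (0ℓ; _⊔_)
open import Data.Nat using (zero; _+_; _≤_; z≤n; s≤s)
open import Data.Nat.Properties using (≤-trans; ≤-reflexive; ≤-pred; n≤1+n; 1+n≰n; +-comm; +-suc; +-identityʳ)
import Data.Fin as Fin
open import Data.Fin.Properties using (any?)
open import Data.Fin.Subset using (_∈_; _⊆_; ∣_∣)
open import Data.Fin.Subset.Properties using (_∈?_; _⊂?_; p⊂q⇒∣p∣<∣q∣; ∣p∣≤n)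
open import Data.Vec using (tabulate)
open import Data.Vec.Properties using (lookup∘tabulate; []=⇒lookup; lookup⇒[]=)
open import Data.List using (List; []; _∷_; _++_; [_]; length; reverse; map; allFin; concat; replicate)
open import Data.List.Properties using (unfold-reverse)
open import Data.List.Extrema.Nat using (max; xs≤max)
open import Data.List.Membership.Propositional.Properties using (∈-map⁺; ∈-allFin)
open import Data.List.Relation.Unary.Any using (here; there)
import Data.List.Relation.Unary.All as All
open import Data.Bool using (Bool; true; false; not; _xor_)
import Data.Bool as Bool
open import Data.Bool.Properties using (xor-same; xor-assoc; xor-identityʳ; not-injective)
open import Data.Unit using (tt)
open import Data.Product using (Σ; _×_; _,_; ∃; proj₁; proj₂)
open import Data.Sum using (_⊎_; inj₁; inj₂)
open import Data.Empty using (⊥-elim)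
open import Function using (case_of_)
open import Function.Bundles using (_⇔_; mk⇔)
open import Relation.Nullary using (¬_; Dec; yes; no; does)
open import Relation.Nullary.Decidable
  using (_⊎-dec_; _×-dec_; ¬?; map′; decidable-stable; dec-true; dec-false; does-⇔)
open import Relation.Unary using (Pred)
import Relation.Unary as U
open import Relation.Binary.Bundles using (Setoid)
open import Relation.Binary.Definitions using (Decidable)
open import Relation.Binary.PropositionalEquality as ≡ using (_≡_)
open import Algebra.Bundles using (Group)
open import Algebra.Structures using (IsGroup)
open import Algebra.Morphism.Structures using (IsGroupHomomorphism)

module _ {a ℓ} (S : Setoid a ℓ) where
  open Setoid S

  enumeration⇒≈-dec : ∀ {n} (enum : Fin n → Carrier) →
                      (∀ x → ∃ λ i → enum i ≈ x) →
                      (∀ i j → enum i ≈ enum j → i ≡ j) →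
                      Decidable _≈_
  enumeration⇒≈-dec enum surj inj x y with surj x | surj y
  ... | i , eᵢ≈x | j , eⱼ≈y with i Fin.≟ j
  ... | yes ≡.refl = yes (trans (sym eᵢ≈x) eⱼ≈y)
  ... | no i≢j     = no λ x≈y → i≢j (inj i j (trans eᵢ≈x (trans x≈y (sym eⱼ≈y))))

module Conjugation {c ℓ} (G : Group c ℓ) where
  open Group G
  open import Algebra.Properties.Group G
  open import Relation.Binary.Reasoning.Setoid setoid

  conj : Carrier → Carrier → Carrier
  conj x t = x ⁻¹ ∙ t ∙ x

  conj-cong : ∀ {x y t u} → x ≈ y → t ≈ u → conj x t ≈ conj y u
  conj-cong x≈y t≈u = ∙-cong (∙-cong (⁻¹-cong x≈y) t≈u) x≈y

  conj-ε : ∀ t → conj ε t ≈ t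
  conj-ε t = begin
    ε ⁻¹ ∙ t ∙ ε ≈⟨ identityʳ _ ⟩
    ε ⁻¹ ∙ t     ≈⟨ ∙-congʳ ε⁻¹≈ε ⟩
    ε ∙ t        ≈⟨ identityˡ t ⟩
    t            ∎

  conj-self : ∀ x → conj x x ≈ x
  conj-self x = trans (∙-congʳ (inverseˡ x)) (identityˡ x)

  conj-∙ : ∀ x y t → conj (x ∙ y) t ≈ conj y (conj x t)
  conj-∙ x y t = begin
    (x ∙ y) ⁻¹ ∙ t ∙ (x ∙ y)      ≈⟨ ∙-congʳ (∙-congʳ (⁻¹-anti-homo-∙ x y)) ⟩
    y ⁻¹ ∙ x ⁻¹ ∙ t ∙ (x ∙ y)     ≈⟨ assoc _ _ _ ⟨
    y ⁻¹ ∙ x ⁻¹ ∙ t ∙ x ∙ y       ≈⟨ ∙-congʳ (∙-congʳ (assoc _ _ _)) ⟩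
    y ⁻¹ ∙ (x ⁻¹ ∙ t) ∙ x ∙ y     ≈⟨ ∙-congʳ (assoc _ _ _) ⟩
    y ⁻¹ ∙ (x ⁻¹ ∙ t ∙ x) ∙ y     ∎

  ∙-conj : ∀ x t → x ∙ conj x t ≈ t ∙ x
  ∙-conj x t = begin
    x ∙ (x ⁻¹ ∙ t ∙ x)  ≈⟨ assoc _ _ _ ⟨
    x ∙ (x ⁻¹ ∙ t) ∙ x  ≈⟨ ∙-congʳ (\\-leftDividesˡ x t) ⟩
    t ∙ x               ∎

  conj-inverseˡ : ∀ x t → conj (x ⁻¹) (conj x t) ≈ t
  conj-inverseˡ x t = begin
    x ⁻¹ ⁻¹ ∙ conj x t ∙ x ⁻¹  ≈⟨ ∙-congʳ (∙-congʳ (⁻¹-involutive x)) ⟩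
    x ∙ conj x t ∙ x ⁻¹        ≈⟨ ∙-congʳ (∙-conj x t) ⟩
    t ∙ x ∙ x ⁻¹               ≈⟨ //-rightDividesʳ x t ⟩
    t                          ∎

  conj-inverseʳ : ∀ x t → conj x (conj (x ⁻¹) t) ≈ t
  conj-inverseʳ x t = trans (conj-cong (sym (⁻¹-involutive x)) refl) (conj-inverseˡ (x ⁻¹) t)

  conj-adjoint : ∀ x t u → (conj x t ≈ u) ⇔ (t ≈ conj (x ⁻¹) u)
  conj-adjoint x t u = mk⇔
    (λ e → trans (sym (conj-inverseˡ x t)) (conj-cong refl e))
    (λ e → trans (conj-cong refl e) (conj-inverseʳ x u))

module PowerSetSemidirectProduct {c ℓ} (G : Group c ℓ) where
  open Group G
  open Conjugation G

  -- W ⋉ 𝒫(W): the subsets of W (as ≈-respecting predicates) form a group under symmetric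
  -- difference, and W acts on it by conjugation.
  record Element : Set (c ⊔ ℓ) where
    field
      base       : Carrier
      marks      : Carrier → Bool
      marks-cong : ∀ {t u} → t ≈ u → marks t ≡ marks u
  open Element public

  infix  4 _≋_
  infixl 7 _⋆_
  infix  8 _⁻¹⋆

  _≋_ : Element → Element → Set (c ⊔ ℓ)
  X ≋ Y = base X ≈ base Y × (∀ t → marks X t ≡ marks Y t)

  _⋆_ : Element → Element → Element
  X ⋆ Y = record
    { base       = base X ∙ base Y
    ; marks      = λ t → marks X t xor marks Y (conj (base X) t)
    ; marks-cong = λ t≈u → ≡.cong₂ _xor_ (marks-cong X t≈u) (marks-cong Y (conj-cong refl t≈u))
    }

  ε⋆ : Element
  ε⋆ = record { base = ε ; marks = λ _ → false ; marks-cong = λ _ → ≡.refl }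

  _⁻¹⋆ : Element → Element
  X ⁻¹⋆ = record
    { base       = base X ⁻¹
    ; marks      = λ t → marks X (conj (base X ⁻¹) t)
    ; marks-cong = λ t≈u → marks-cong X (conj-cong refl t≈u)
    }

  ⋆-cong : ∀ {X X′ Y Y′} → X ≋ X′ → Y ≋ Y′ → X ⋆ Y ≋ X′ ⋆ Y′
  ⋆-cong {Y = Y} (x≈ , X≡) (y≈ , Y≡) =
    ∙-cong x≈ y≈ ,
    λ t → ≡.cong₂ _xor_ (X≡ t) (≡.trans (marks-cong Y (conj-cong x≈ refl)) (Y≡ _))

  ⋆-assoc : ∀ X Y Z → X ⋆ Y ⋆ Z ≋ X ⋆ (Y ⋆ Z)
  ⋆-assoc X Y Z = assoc _ _ _ , λ t →
    ≡.trans (xor-assoc (marks X t) (marks Y (conj (base X) t)) _)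
            (≡.cong (λ b → marks X t xor (marks Y (conj (base X) t) xor b))
                    (marks-cong Z (conj-∙ (base X) (base Y) t)))

  ⁻¹⋆-cong : ∀ {X Y} → X ≋ Y → X ⁻¹⋆ ≋ Y ⁻¹⋆
  ⁻¹⋆-cong {X} (x≈ , X≡) =
    ⁻¹-cong x≈ , λ t → ≡.trans (marks-cong X (conj-cong (⁻¹-cong x≈) refl)) (X≡ _)

  ⋉-isGroup : IsGroup _≋_ _⋆_ ε⋆ _⁻¹⋆
  ⋉-isGroup = record
    { isMonoid = record
      { isSemigroup = record
        { isMagma = record
          { isEquivalence = record
            { refl  = refl , λ _ → ≡.refl
            ; sym   = λ (x≈ , X≡) → sym x≈ , λ t → ≡.sym (X≡ t)
            ; trans = λ (x≈ , X≡) (y≈ , Y≡) → trans x≈ y≈ , λ t → ≡.trans (X≡ t) (Y≡ t)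
            }
          ; ∙-cong = λ {X} {X′} {Y} {Y′} → ⋆-cong {X} {X′} {Y} {Y′}
          }
        ; assoc = ⋆-assoc
        }
      ; identity = (λ X → identityˡ (base X) , λ t → marks-cong X (conj-ε t))
                 , (λ X → identityʳ (base X) , λ t → xor-identityʳ (marks X t))
      }
    ; inverse = (λ X → inverseˡ (base X) , λ t → xor-same (marks X (conj (base X ⁻¹) t)))
              , (λ X → inverseʳ (base X) , λ t →
                   ≡.trans (≡.cong (marks X t xor_) (marks-cong X (conj-inverseˡ (base X) t))) (xor-same (marks X t)))
    ; ⁻¹-cong = λ {X} {Y} → ⁻¹⋆-cong {X} {Y}
    }

  ⋉-group : Group (c ⊔ ℓ) (c ⊔ ℓ)
  ⋉-group = record { isGroup = ⋉-isGroup }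

xorSum : ℕ → (ℕ → Bool) → Bool
xorSum zero    f = false
xorSum (suc n) f = f 0 xor xorSum n (λ q → f (suc q))

xorSum-cong : ∀ n {f g : ℕ → Bool} → (∀ q → f q ≡ g q) → xorSum n f ≡ xorSum n g
xorSum-cong zero    f≗g = ≡.refl
xorSum-cong (suc n) f≗g = ≡.cong₂ _xor_ (f≗g 0) (xorSum-cong n (λ q → f≗g (suc q)))

xorSum-+ : ∀ m n f → xorSum (m + n) f ≡ xorSum m f xor xorSum n (λ q → f (m + q))
xorSum-+ zero    n f = ≡.refl
xorSum-+ (suc m) n f =
  ≡.trans (≡.cong (f 0 xor_) (xorSum-+ m n (λ q → f (suc q)))) (≡.sym (xor-assoc (f 0) _ _))

xorSum-periodic : ∀ m f → (∀ q → f (m + q) ≡ f q) → xorSum (m + m) f ≡ false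
xorSum-periodic m f periodic = begin
  xorSum (m + m) f                                   ≡⟨ xorSum-+ m m f ⟩
  xorSum m f xor xorSum m (λ q → f (m + q))          ≡⟨ ≡.cong (xorSum m f xor_) (xorSum-cong m periodic) ⟩
  xorSum m f xor xorSum m f                          ≡⟨ xor-same (xorSum m f) ⟩
  false                                              ∎
  where open ≡.≡-Reasoning

double : ℕ → ℕ
double zero    = zero
double (suc n) = suc (suc (double n))

double≡+ : ∀ n → double n ≡ n + n
double≡+ zero    = ≡.refl
double≡+ (suc n) = ≡.cong suc (≡.trans (≡.cong suc (double≡+ n)) (≡.sym (+-suc n n)))

module Powers (G : Group 0ℓ 0ℓ) where
  open Group G

  pow-+ : ∀ x m n → pow G x (m + n) ≈ pow G x m ∙ pow G x n
  pow-+ x zero    n = sym (identityˡ _)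
  pow-+ x (suc m) n = trans (∙-congˡ (pow-+ x m n)) (sym (assoc _ _ _))

  pow-comm : ∀ x n → pow G x n ∙ x ≈ x ∙ pow G x n
  pow-comm x zero    = trans (identityˡ x) (sym (identityʳ x))
  pow-comm x (suc n) = trans (assoc _ _ _) (∙-congˡ (pow-comm x n))

module DihedralLift (G : Group 0ℓ 0ℓ) (_≟_ : Decidable (Group._≈_ G)) where
  open Group G
  open import Algebra.Properties.Group G
  open Conjugation G
  open PowerSetSemidirectProduct G
  open Powers G

  infix 4 _≈ᵇ_
  _≈ᵇ_ : Carrier → Carrier → Bool
  t ≈ᵇ u = does (t ≟ u)

  ≈ᵇ-cong : ∀ {t t′ u u′} → t ≈ t′ → u ≈ u′ → (t ≈ᵇ u) ≡ (t′ ≈ᵇ u′)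
  ≈ᵇ-cong t≈t′ u≈u′ = does-⇔
    (mk⇔ (λ e → trans (sym t≈t′) (trans e u≈u′)) (λ e → trans t≈t′ (trans e (sym u≈u′))))
    (_ ≟ _) (_ ≟ _)

  ≈ᵇ-refl : ∀ t → (t ≈ᵇ t) ≡ true
  ≈ᵇ-refl t = dec-true (t ≟ t) refl

  ≈ᵇ-true⇒≈ : ∀ {t u} → (t ≈ᵇ u) ≡ true → t ≈ u
  ≈ᵇ-true⇒≈ {t} {u} e with t ≟ u
  ... | yes t≈u = t≈u
  ... | no _ with () ← e

  marked : Carrier → Element
  marked σ = record { base = σ ; marks = (_≈ᵇ σ) ; marks-cong = λ t≈u → ≈ᵇ-cong t≈u refl }

  module _ {σ τ : Carrier} (σσ≈ε : σ ∙ σ ≈ ε) (ττ≈ε : τ ∙ τ ≈ ε) where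

    private
      x : Carrier
      x = σ ∙ τ

      X : Element
      X = marked σ ⋆ marked τ

      σ⁻¹≈σ : σ ⁻¹ ≈ σ
      σ⁻¹≈σ = sym (inverseʳ-unique σ σ σσ≈ε)

      x⁻¹≈τσ : x ⁻¹ ≈ τ ∙ σ
      x⁻¹≈τσ = trans (⁻¹-anti-homo-∙ σ τ) (∙-cong (sym (inverseʳ-unique τ τ ττ≈ε)) σ⁻¹≈σ)

      reflection : ℕ → Carrier
      reflection q = pow G x q ∙ σ

      conj-reflection : ∀ q → conj (x ⁻¹) (reflection q) ≈ reflection (2 + q)
      conj-reflection q = begin
        x ⁻¹ ⁻¹ ∙ (xᵠ ∙ σ) ∙ x ⁻¹  ≈⟨ ∙-congʳ (∙-congʳ (⁻¹-involutive x)) ⟩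
        x ∙ (xᵠ ∙ σ) ∙ x ⁻¹        ≈⟨ assoc _ _ _ ⟩
        x ∙ (xᵠ ∙ σ ∙ x ⁻¹)        ≈⟨ ∙-congˡ (assoc _ _ _) ⟩
        x ∙ (xᵠ ∙ (σ ∙ x ⁻¹))      ≈⟨ ∙-congˡ (∙-congˡ σx⁻¹≈xσ) ⟩
        x ∙ (xᵠ ∙ (x ∙ σ))         ≈⟨ ∙-congˡ (assoc _ _ _) ⟨
        x ∙ (xᵠ ∙ x ∙ σ)           ≈⟨ ∙-congˡ (∙-congʳ (pow-comm x q)) ⟩
        x ∙ (x ∙ xᵠ ∙ σ)           ≈⟨ assoc _ _ _ ⟨
        x ∙ (x ∙ xᵠ) ∙ σ           ∎
        where
          open import Relation.Binary.Reasoning.Setoid setoid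
          xᵠ : Carrier
          xᵠ = pow G x q
          σx⁻¹≈xσ : σ ∙ x ⁻¹ ≈ x ∙ σ
          σx⁻¹≈xσ = trans (∙-congˡ x⁻¹≈τσ) (sym (assoc _ _ _))

      base-pow : ∀ n → base (pow ⋉-group X n) ≈ pow G x n
      base-pow zero    = refl
      base-pow (suc n) = ∙-congˡ (base-pow n)

      marks-pow : ∀ n t → marks (pow ⋉-group X n) t ≡ xorSum (double n) (λ q → t ≈ᵇ reflection q)
      marks-pow zero    t = ≡.refl
      marks-pow (suc n) t = begin
        ((t ≈ᵇ σ) xor (conj σ t ≈ᵇ τ)) xor marks (pow ⋉-group X n) (conj x t)
          ≡⟨ ≡.cong₂ (λ a b → ((t ≈ᵇ σ) xor a) xor b) second-mark (marks-pow n (conj x t)) ⟩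
        ((t ≈ᵇ σ) xor (t ≈ᵇ reflection 1)) xor xorSum (double n) (λ q → conj x t ≈ᵇ reflection q)
          ≡⟨ xor-assoc (t ≈ᵇ σ) _ _ ⟩
        (t ≈ᵇ σ) xor ((t ≈ᵇ reflection 1) xor xorSum (double n) (λ q → conj x t ≈ᵇ reflection q))
          ≡⟨ ≡.cong₂ (λ a b → a xor ((t ≈ᵇ reflection 1) xor b))
                     (≈ᵇ-cong refl (sym (identityˡ σ)))
                     (xorSum-cong (double n) λ q → ≡.trans (conj-mark x t (reflection q))
                                                           (≈ᵇ-cong refl (conj-reflection q))) ⟩
        xorSum (double (suc n)) (λ q → t ≈ᵇ reflection q) ∎
        where
          open ≡.≡-Reasoning
          conj-mark : ∀ y t u → (conj y t ≈ᵇ u) ≡ (t ≈ᵇ conj (y ⁻¹) u)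
          conj-mark y t u = does-⇔ (conj-adjoint y t u) (_ ≟ _) (_ ≟ _)
          second-mark : (conj σ t ≈ᵇ τ) ≡ (t ≈ᵇ reflection 1)
          second-mark = ≡.trans (conj-mark σ t τ)
            (≈ᵇ-cong refl (∙-cong (trans (∙-congʳ (⁻¹-involutive σ)) (sym (identityʳ x))) σ⁻¹≈σ))

    -- The marks of (marked σ ⋆ marked τ) ^ n are reflection 0, …, reflection (2n - 1), counted
    -- mod 2.  When (σ τ) ^ m ≈ ε this list is periodic with period m, so its 2m entries cancel.
    marked-relation : ∀ m → pow G (σ ∙ τ) m ≈ ε → pow ⋉-group (marked σ ⋆ marked τ) m ≋ ε⋆
    marked-relation m xᵐ≈ε = trans (base-pow m) xᵐ≈ε , λ t → begin
      marks (pow ⋉-group X m) t                     ≡⟨ marks-pow m t ⟩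
      xorSum (double m) (λ q → t ≈ᵇ reflection q)   ≡⟨ ≡.cong (λ n → xorSum n _) (double≡+ m) ⟩
      xorSum (m + m) (λ q → t ≈ᵇ reflection q)      ≡⟨ xorSum-periodic m _ (λ q → ≈ᵇ-cong refl (periodic q)) ⟩
      false                                         ∎
      where
        open ≡.≡-Reasoning
        periodic : ∀ q → reflection (m + q) ≈ reflection q
        periodic q = ∙-congʳ (trans (pow-+ x m q) (trans (∙-congʳ xᵐ≈ε) (identityˡ _)))

module _ {m} {P : Pred (Fin m) 0ℓ} (P? : U.Decidable P) where

  toSubset : Subset m
  toSubset = tabulate (λ a → does (P? a))

  ∈toSubset⁺ : ∀ {a} → P a → a ∈ toSubset
  ∈toSubset⁺ {a} pa = lookup⇒[]= a toSubset (≡.trans (lookup∘tabulate _ a) (dec-true (P? a) pa))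

  ∈toSubset⁻ : ∀ {a} → a ∈ toSubset → P a
  ∈toSubset⁻ {a} a∈ with P? a | ≡.trans (≡.sym (lookup∘tabulate (λ a → does (P? a)) a)) ([]=⇒lookup a∈)
  ... | yes pa | _ = pa

module _ {m} (D : ℕ → Subset m) (mono : ∀ n → D n ⊆ D (suc n)) where

  stabilises-or-grows : ∀ c → (∃ λ n → D (suc n) ⊆ D n) ⊎ c ≤ ∣ D c ∣
  stabilises-or-grows zero = inj₂ z≤n
  stabilises-or-grows (suc c) with stabilises-or-grows c
  ... | inj₁ stable = inj₁ stable
  ... | inj₂ c≤∣Dc∣ with D c ⊂? D (suc c)
  ...   | yes Dc⊂ = inj₂ (≤-trans (s≤s c≤∣Dc∣) (p⊂q⇒∣p∣<∣q∣ Dc⊂))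
  ...   | no ¬Dc⊂ =
    inj₁ (c , λ {a} a∈ → decidable-stable (a ∈? D c) (λ a∉ → ¬Dc⊂ (mono c , a , a∈ , a∉)))

  chain-stabilises : ∃ λ n → D (suc n) ⊆ D n
  chain-stabilises with stabilises-or-grows (suc m)
  ... | inj₁ stable = stable
  ... | inj₂ m<∣D∣  = ⊥-elim (1+n≰n (≤-trans m<∣D∣ (∣p∣≤n (D (suc m)))))

module SubgroupMembership (G : Group 0ℓ 0ℓ) where
  open Group G
  open import Algebra.Properties.Group G

  module _ {size : ℕ} (enum : Fin size → Carrier) (enum-surj : ∀ x → ∃ λ a → enum a ≈ x)
           (_≟_ : Decidable _≈_)
           {k : ℕ} (s : Fin k → Carrier) (s-involutive : ∀ i → s i ∙ s i ≈ ε)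
           (J : Subset k) where

    Reach : ℕ → Carrier → Set
    Reach zero    x = x ≈ ε
    Reach (suc n) x = Reach n x ⊎ ∃ λ i → i ∈ J × Reach n (x ∙ s i)

    reach? : ∀ n x → Dec (Reach n x)
    reach? zero    x = x ≟ ε
    reach? (suc n) x = reach? n x ⊎-dec any? (λ i → (i ∈? J) ×-dec reach? n (x ∙ s i))

    Reach-resp : ∀ n {x y} → x ≈ y → Reach n x → Reach n y
    Reach-resp zero    x≈y x≈ε                     = trans (sym x≈y) x≈ε
    Reach-resp (suc n) x≈y (inj₁ r)                = inj₁ (Reach-resp n x≈y r)
    Reach-resp (suc n) x≈y (inj₂ (i , i∈J , r))    = inj₂ (i , i∈J , Reach-resp n (∙-congʳ x≈y) r)

    Reach⇒InSubgroup : ∀ n {x} → Reach n x → InSubgroup G s J x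
    Reach⇒InSubgroup zero    x≈ε                   = resp (sym x≈ε) one
    Reach⇒InSubgroup (suc n) (inj₁ r)              = Reach⇒InSubgroup n r
    Reach⇒InSubgroup (suc n) {x} (inj₂ (i , i∈J , r)) =
      resp (trans (assoc _ _ _) (trans (∙-congˡ (s-involutive i)) (identityʳ x)))
           (mul (Reach⇒InSubgroup n r) (gen i∈J))

    Reach-weaken : ∀ d {n x} → Reach n x → Reach (d + n) x
    Reach-weaken zero    r = r
    Reach-weaken (suc d) r = inj₁ (Reach-weaken d r)

    Reach-∙ : ∀ n m {x y} → Reach n x → Reach m y → Reach (m + n) (x ∙ y)
    Reach-∙ n zero    {x} rx y≈ε                  = Reach-resp n (sym (trans (∙-congˡ y≈ε) (identityʳ x))) rx
    Reach-∙ n (suc m) rx (inj₁ ry)                = inj₁ (Reach-∙ n m rx ry)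
    Reach-∙ n (suc m) rx (inj₂ (i , i∈J , ry))    =
      inj₂ (i , i∈J , Reach-resp (m + n) (sym (assoc _ _ _)) (Reach-∙ n m rx ry))

    Reach-⁻¹ : ∀ n {x} → Reach n x → Reach n (x ⁻¹)
    Reach-⁻¹ zero    x≈ε                          = trans (⁻¹-cong x≈ε) ε⁻¹≈ε
    Reach-⁻¹ (suc n) (inj₁ r)                     = inj₁ (Reach-⁻¹ n r)
    Reach-⁻¹ (suc n) {x} (inj₂ (i , i∈J , r))     =
      ≡.subst (λ j → Reach j (x ⁻¹)) (+-comm n 1)
        (Reach-resp (n + 1) sᵢ[xsᵢ]⁻¹≈x⁻¹
          (Reach-∙ 1 n (inj₂ (i , i∈J , s-involutive i)) (Reach-⁻¹ n r)))
      where
        open import Relation.Binary.Reasoning.Setoid setoid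
        sᵢ[xsᵢ]⁻¹≈x⁻¹ : s i ∙ (x ∙ s i) ⁻¹ ≈ x ⁻¹
        sᵢ[xsᵢ]⁻¹≈x⁻¹ = begin
          s i ∙ (x ∙ s i) ⁻¹         ≈⟨ ∙-congˡ (⁻¹-anti-homo-∙ x (s i)) ⟩
          s i ∙ (s i ⁻¹ ∙ x ⁻¹)      ≈⟨ \\-leftDividesˡ (s i) (x ⁻¹) ⟩
          x ⁻¹                       ∎

    InSubgroup⇒Reach : ∀ {x} → InSubgroup G s J x → ∃ λ n → Reach n x
    InSubgroup⇒Reach (gen i∈J)    = 1 , inj₂ (_ , i∈J , s-involutive _)
    InSubgroup⇒Reach one          = 0 , refl
    InSubgroup⇒Reach (mul p q) with InSubgroup⇒Reach p | InSubgroup⇒Reach q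
    ... | n , rp | m , rq         = m + n , Reach-∙ n m rp rq
    InSubgroup⇒Reach (inv p) with InSubgroup⇒Reach p
    ... | n , rp                  = n , Reach-⁻¹ n rp
    InSubgroup⇒Reach (resp x≈y p) with InSubgroup⇒Reach p
    ... | n , rp                  = n , Reach-resp n x≈y rp

    Stable : ℕ → Set
    Stable n = ∀ {x} → Reach (suc n) x → Reach n x

    reachSet : ℕ → Subset size
    reachSet n = toSubset (λ a → reach? n (enum a))

    ∈reachSet⁺ : ∀ n {a} → Reach n (enum a) → a ∈ reachSet n
    ∈reachSet⁺ n = ∈toSubset⁺ (λ a → reach? n (enum a))

    ∈reachSet⁻ : ∀ n {a} → a ∈ reachSet n → Reach n (enum a)
    ∈reachSet⁻ n = ∈toSubset⁻ (λ a → reach? n (enum a))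

    stable : ∃ Stable
    stable with chain-stabilises reachSet (λ n a∈ → ∈reachSet⁺ (suc n) (inj₁ (∈reachSet⁻ n a∈)))
    ... | n , reachSet-stable = n , λ {x} r → let (a , eₐ≈x) = enum-surj x in
      Reach-resp n eₐ≈x
        (∈reachSet⁻ n (reachSet-stable (∈reachSet⁺ (suc n) (Reach-resp (suc n) (sym eₐ≈x) r))))

    Stable-suc : ∀ {n} → Stable n → Stable (suc n)
    Stable-suc st (inj₁ r)              = r
    Stable-suc st (inj₂ (i , i∈J , r))  = inj₂ (i , i∈J , st r)

    Stable-absorbs : ∀ {n} → Stable n → ∀ d {x} → Reach (d + n) x → Reach n x
    Stable-absorbs st zero    r = r
    Stable-absorbs {n} st (suc d) r = Stable-absorbs st d (Stable-+ d r)
      where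
        Stable-+ : ∀ d → Stable (d + n)
        Stable-+ zero    = st
        Stable-+ (suc d) = Stable-suc {d + n} (Stable-+ d)

    InSubgroup? : ∀ x → Dec (InSubgroup G s J x)
    InSubgroup? x = let (n , st) = stable in
      map′ (Reach⇒InSubgroup n) (λ p → let (m , r) = InSubgroup⇒Reach p in
             Stable-absorbs st m (≡.subst (λ j → Reach j x) (+-comm n m) (Reach-weaken n r)))
           (reach? n x)

module CoxeterGroup (C : CoxeterSystem) where
  open CoxeterSystem C
  open import Algebra.Properties.Group W
  open Conjugation W public
  open PowerSetSemidirectProduct W

  _≟_ : Decidable _≈_
  _≟_ = enumeration⇒≈-dec setoid enum enum-surj enum-inj

  open DihedralLift W _≟_ using (_≈ᵇ_; ≈ᵇ-true⇒≈; ≈ᵇ-refl; marked; marked-relation)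

  s-involutive : ∀ i → s i ∙ s i ≈ ε
  s-involutive i =
    trans (sym (identityʳ _)) (≡.subst (λ n → pow W (s i ∙ s i) n ≈ ε) (m-diag i) (relations i i))

  s⁻¹≈s : ∀ i → s i ⁻¹ ≈ s i
  s⁻¹≈s i = sym (inverseʳ-unique (s i) (s i) (s-involutive i))

  s-cancel : ∀ i x → s i ∙ (s i ∙ x) ≈ x
  s-cancel i x = trans (sym (assoc _ _ _)) (trans (∙-congʳ (s-involutive i)) (identityˡ x))

  InSubgroup? : ∀ J x → Dec (InSubgroup W s J x)
  InSubgroup? = SubgroupMembership.InSubgroup? W enum enum-surj _≟_ s s-involutive

  conj-closed : ∀ {J g t} → InSubgroup W s J g → InSubgroup W s J t → InSubgroup W s J (conj g t)
  conj-closed g t = mul (mul (inv g) t) g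

  -- The Coxeter presentation is used exactly here: s i ↦ marked (s i) extends to a homomorphism
  -- W → W ⋉ 𝒫(W).  Its second component N w is the set of reflections t with ℓ(t w) < ℓ(w).
  private
    lifting : Σ (Carrier → Element) λ h →
                IsGroupHomomorphism rawGroup (Group.rawGroup ⋉-group) h × (∀ i → h (s i) ≋ marked (s i))
    lifting = universal ⋉-group (λ i → marked (s i))
                (λ i j → marked-relation (s-involutive i) (s-involutive j) (m i j) (relations i j))
    module lift = IsGroupHomomorphism (proj₁ (proj₂ lifting))

  lift : Carrier → Element
  lift = proj₁ lifting

  N : Carrier → Carrier → Bool
  N w = marks (lift w)

  base∘lift : ∀ {J x} → InSubgroup W s J x → base (lift x) ≈ x
  base∘lift (gen {i} _)   = proj₁ (proj₂ (proj₂ lifting) i)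
  base∘lift one           = proj₁ lift.ε-homo
  base∘lift (mul p q)     = trans (proj₁ (lift.homo _ _)) (∙-cong (base∘lift p) (base∘lift q))
  base∘lift (inv p)       = trans (proj₁ (lift.⁻¹-homo _)) (⁻¹-cong (base∘lift p))
  base∘lift (resp x≈y p)  = trans (sym (proj₁ (lift.⟦⟧-cong x≈y))) (trans (base∘lift p) x≈y)

  N-cong : ∀ {x y} → x ≈ y → ∀ t → N x t ≡ N y t
  N-cong x≈y = proj₂ (lift.⟦⟧-cong x≈y)

  N-resp : ∀ x {t u} → t ≈ u → N x t ≡ N x u
  N-resp x = marks-cong (lift x)

  N-ε : ∀ t → N ε t ≡ false
  N-ε = proj₂ lift.ε-homo

  N-s : ∀ i t → N (s i) t ≡ (t ≈ᵇ s i)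
  N-s i = proj₂ (proj₂ (proj₂ lifting) i)

  N-∙ : ∀ x y t → N (x ∙ y) t ≡ N x t xor N y (conj x t)
  N-∙ x y t = ≡.trans (proj₂ (lift.homo x y) t)
                      (≡.cong (N x t xor_) (N-resp y (conj-cong (base∘lift (generated x)) refl)))

  N-⁻¹ : ∀ x t → N (x ⁻¹) t ≡ N x (conj (x ⁻¹) t)
  N-⁻¹ x t = ≡.trans (proj₂ (lift.⁻¹-homo x) t)
                     (N-resp x (conj-cong (⁻¹-cong (base∘lift (generated x))) refl))

  N-s∙ : ∀ i w → N (s i ∙ w) (s i) ≡ not (N w (s i))
  N-s∙ i w = ≡.trans (N-∙ (s i) w (s i))
                     (≡.cong₂ _xor_ (≡.trans (N-s i (s i)) (≈ᵇ-refl (s i))) (N-resp w (conj-self (s i))))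

  N-parabolic : ∀ {J g} → InSubgroup W s J g → ∀ {t} → N g t ≡ true → InSubgroup W s J t
  N-parabolic (gen {i} i∈J) {t} Nt = resp (sym (≈ᵇ-true⇒≈ (≡.trans (≡.sym (N-s i t)) Nt))) (gen i∈J)
  N-parabolic one {t} Nt with () ← ≡.trans (≡.sym (N-ε t)) Nt
  N-parabolic (mul {x} {y} p q) {t} Nt with N x t in Nxt
  ... | true  = N-parabolic p Nxt
  ... | false = resp (conj-inverseˡ x t) (conj-closed (inv p) (N-parabolic q Nyt))
    where
      Nyt : N y (conj x t) ≡ true
      Nyt = ≡.trans (≡.cong (_xor N y (conj x t)) (≡.sym Nxt)) (≡.trans (≡.sym (N-∙ x y t)) Nt)
  N-parabolic (inv {x} p) {t} Nt =
    resp (conj-inverseʳ x t) (conj-closed p (N-parabolic p (≡.trans (≡.sym (N-⁻¹ x t)) Nt)))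
  N-parabolic (resp x≈y p) {t} Nt = N-parabolic p (≡.trans (N-cong x≈y t) Nt)

  ⟦_⟧ : List (Fin k) → Carrier
  ⟦ [] ⟧     = ε
  ⟦ i ∷ is ⟧ = s i ∙ ⟦ is ⟧

  ⟦⟧-++ : ∀ is js → ⟦ is ++ js ⟧ ≈ ⟦ is ⟧ ∙ ⟦ js ⟧
  ⟦⟧-++ []       js = sym (identityˡ _)
  ⟦⟧-++ (i ∷ is) js = trans (∙-congˡ (⟦⟧-++ is js)) (sym (assoc _ _ _))

  ⟦⟧-reverse : ∀ is → ⟦ reverse is ⟧ ≈ ⟦ is ⟧ ⁻¹
  ⟦⟧-reverse []       = sym ε⁻¹≈ε
  ⟦⟧-reverse (i ∷ is) = begin
    ⟦ reverse (i ∷ is) ⟧          ≡⟨ ≡.cong ⟦_⟧ (unfold-reverse i is) ⟩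
    ⟦ reverse is ++ [ i ] ⟧       ≈⟨ ⟦⟧-++ (reverse is) [ i ] ⟩
    ⟦ reverse is ⟧ ∙ (s i ∙ ε)    ≈⟨ ∙-cong (⟦⟧-reverse is) (trans (identityʳ _) (sym (s⁻¹≈s i))) ⟩
    ⟦ is ⟧ ⁻¹ ∙ s i ⁻¹            ≈⟨ ⁻¹-anti-homo-∙ (s i) ⟦ is ⟧ ⟨
    (s i ∙ ⟦ is ⟧) ⁻¹             ∎
    where open import Relation.Binary.Reasoning.Setoid setoid

  InSubgroup⇒word : ∀ {J x} → InSubgroup W s J x → ∃ λ is → ⟦ is ⟧ ≈ x
  InSubgroup⇒word (gen {i} _)  = [ i ] , identityʳ (s i)
  InSubgroup⇒word one          = [] , refl
  InSubgroup⇒word (mul p q) with InSubgroup⇒word p | InSubgroup⇒word q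
  ... | is , ⟦is⟧≈x | js , ⟦js⟧≈y = is ++ js , trans (⟦⟧-++ is js) (∙-cong ⟦is⟧≈x ⟦js⟧≈y)
  InSubgroup⇒word (inv p) with InSubgroup⇒word p
  ... | is , ⟦is⟧≈x = reverse is , trans (⟦⟧-reverse is) (⁻¹-cong ⟦is⟧≈x)
  InSubgroup⇒word (resp x≈y p) with InSubgroup⇒word p
  ... | is , ⟦is⟧≈x = is , trans ⟦is⟧≈x x≈y

  word-length-bound : ∃ λ B → ∀ x → ∃ λ is → length is ≤ B × ⟦ is ⟧ ≈ x
  word-length-bound = max 0 lengths , bounded
    where
      wordOf : Fin size → List (Fin k)
      wordOf a = proj₁ (InSubgroup⇒word (generated (enum a)))
      lengths : List ℕ
      lengths = map (λ a → length (wordOf a)) (allFin size)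
      bounded : ∀ x → ∃ λ is → length is ≤ max 0 lengths × ⟦ is ⟧ ≈ x
      bounded x = let (a , eₐ≈x) = enum-surj x in
        wordOf a ,
        All.lookup (xs≤max 0 lengths) (∈-map⁺ (λ a → length (wordOf a)) (∈-allFin a)) ,
        trans (proj₂ (InSubgroup⇒word (generated (enum a)))) eₐ≈x

  strong-exchange : ∀ is {t} → N ⟦ is ⟧ t ≡ true →
                    ∃ λ js → suc (length js) ≡ length is × t ∙ ⟦ is ⟧ ≈ ⟦ js ⟧
  strong-exchange [] {t} Nt with () ← ≡.trans (≡.sym (N-ε t)) Nt
  strong-exchange (i ∷ is) {t} Nt with t ≟ s i
  ... | yes t≈sᵢ = is , ≡.refl , trans (∙-congʳ t≈sᵢ) (s-cancel i ⟦ is ⟧)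
  ... | no t≉sᵢ with strong-exchange is {conj (s i) t} Nt′
    where
      Nt′ : N ⟦ is ⟧ (conj (s i) t) ≡ true
      Nt′ = begin
        N ⟦ is ⟧ (conj (s i) t)                  ≡⟨ ≡.cong (_xor N ⟦ is ⟧ (conj (s i) t)) (dec-false (t ≟ s i) t≉sᵢ) ⟨
        (t ≈ᵇ s i) xor N ⟦ is ⟧ (conj (s i) t)   ≡⟨ ≡.cong (_xor N ⟦ is ⟧ (conj (s i) t)) (N-s i t) ⟨
        N (s i) t xor N ⟦ is ⟧ (conj (s i) t)    ≡⟨ N-∙ (s i) ⟦ is ⟧ t ⟨
        N (s i ∙ ⟦ is ⟧) t                       ≡⟨ Nt ⟩
        true                                     ∎
        where open ≡.≡-Reasoning
  ... | js , |js|+1≡|is| , t′⟦is⟧≈⟦js⟧ = i ∷ js , ≡.cong suc |js|+1≡|is| , (begin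
    t ∙ (s i ∙ ⟦ is ⟧)              ≈⟨ assoc _ _ _ ⟨
    t ∙ s i ∙ ⟦ is ⟧                ≈⟨ ∙-congʳ (∙-conj (s i) t) ⟨
    s i ∙ conj (s i) t ∙ ⟦ is ⟧     ≈⟨ assoc _ _ _ ⟩
    s i ∙ (conj (s i) t ∙ ⟦ is ⟧)   ≈⟨ ∙-congˡ t′⟦is⟧≈⟦js⟧ ⟩
    s i ∙ ⟦ js ⟧                    ∎)
    where open import Relation.Binary.Reasoning.Setoid setoid

  -- Fixed J a w means s a · w W_J = w W_J
  Fixed : Subset k → Fin k → Carrier → Set
  Fixed J a w = InSubgroup W s J (conj w (s a))

  -- OnSide J a b w: the coset w W_J is moved by s a, and b records on which side of
  -- the wall of s a it lies (true: s a shortens every element of the coset)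
  OnSide : Subset k → Fin k → Bool → Carrier → Set
  OnSide J a b w = ¬ Fixed J a w × N w (s a) ≡ b

  CosetLength≤ : Subset k → Carrier → ℕ → Set
  CosetLength≤ J w n = ∃ λ is → length is ≤ n × InSubgroup W s J (w ⁻¹ ∙ ⟦ is ⟧)

  module _ {J : Subset k} where

    ≈⇒coset : ∀ {x y} → x ≈ y → InSubgroup W s J (x ⁻¹ ∙ y)
    ≈⇒coset {x} {y} x≈y = resp (sym (trans (∙-congʳ (⁻¹-cong x≈y)) (inverseˡ y))) one

    coset-sym : ∀ {w w′} → InSubgroup W s J (w ⁻¹ ∙ w′) → InSubgroup W s J (w′ ⁻¹ ∙ w)
    coset-sym {w} {w′} g = resp (trans (⁻¹-anti-homo-∙ (w ⁻¹) w′) (∙-congˡ (⁻¹-involutive w))) (inv g)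

    s∙-quotient : ∀ a w u → (s a ∙ w) ⁻¹ ∙ u ≈ w ⁻¹ ∙ (s a ∙ u)
    s∙-quotient a w u = begin
      (s a ∙ w) ⁻¹ ∙ u       ≈⟨ ∙-congʳ (⁻¹-anti-homo-∙ (s a) w) ⟩
      w ⁻¹ ∙ s a ⁻¹ ∙ u      ≈⟨ assoc _ _ _ ⟩
      w ⁻¹ ∙ (s a ⁻¹ ∙ u)    ≈⟨ ∙-congˡ (∙-congʳ (s⁻¹≈s a)) ⟩
      w ⁻¹ ∙ (s a ∙ u)       ∎
      where open import Relation.Binary.Reasoning.Setoid setoid

    s∙-coset : ∀ a {w u} → InSubgroup W s J (w ⁻¹ ∙ u) → InSubgroup W s J ((s a ∙ w) ⁻¹ ∙ (s a ∙ u))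
    s∙-coset a {w} {u} g = resp (sym (trans (s∙-quotient a w (s a ∙ u)) (∙-congˡ (s-cancel a u)))) g

    s∙-coset⁻ : ∀ a {w u} → InSubgroup W s J ((s a ∙ w) ⁻¹ ∙ u) → InSubgroup W s J (w ⁻¹ ∙ (s a ∙ u))
    s∙-coset⁻ a {w} {u} g = resp (s∙-quotient a w u) g

    Fixed-resp : ∀ a {w w′} → InSubgroup W s J (w ⁻¹ ∙ w′) → Fixed J a w → Fixed J a w′
    Fixed-resp a {w} {w′} g f =
      resp (trans (sym (conj-∙ w (w ⁻¹ ∙ w′) (s a))) (conj-cong (\\-leftDividesˡ w w′) refl)) (conj-closed g f)

    Fixed⇒coset : ∀ a {w} → Fixed J a w → InSubgroup W s J ((s a ∙ w) ⁻¹ ∙ w)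
    Fixed⇒coset a {w} f = resp (sym (trans (s∙-quotient a w w) (sym (assoc _ _ _)))) f

    Fixed-s∙ : ∀ a {w} → Fixed J a (s a ∙ w) → Fixed J a w
    Fixed-s∙ a {w} f = resp (trans (conj-∙ (s a) w (s a)) (conj-cong refl (conj-self (s a)))) f

    -- the correction term N (w ⁻¹ ∙ w′) (conj w (s a)) vanishes by N-parabolic
    N-coset : ∀ a {w w′} → InSubgroup W s J (w ⁻¹ ∙ w′) → ¬ Fixed J a w → N w (s a) ≡ N w′ (s a)
    N-coset a {w} {w′} g nf with N (w ⁻¹ ∙ w′) (conj w (s a)) in Ng
    ... | true  = ⊥-elim (nf (N-parabolic g Ng))
    ... | false = begin
      N w (s a)                                                  ≡⟨ xor-identityʳ _ ⟨
      N w (s a) xor false                                        ≡⟨ ≡.cong (N w (s a) xor_) Ng ⟨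
      N w (s a) xor N (w ⁻¹ ∙ w′) (conj w (s a))                 ≡⟨ N-∙ w (w ⁻¹ ∙ w′) (s a) ⟨
      N (w ∙ (w ⁻¹ ∙ w′)) (s a)                                  ≡⟨ N-cong (\\-leftDividesˡ w w′) (s a) ⟩
      N w′ (s a)                                                 ∎
      where open ≡.≡-Reasoning

    OnSide-resp : ∀ a {b w w′} → InSubgroup W s J (w ⁻¹ ∙ w′) → OnSide J a b w → OnSide J a b w′
    OnSide-resp a g (nf , Nw) = (λ f → nf (Fixed-resp a (coset-sym g) f)) , ≡.trans (≡.sym (N-coset a g nf)) Nw

    OnSide-s∙ : ∀ a {b w} → OnSide J a b w → OnSide J a (not b) (s a ∙ w)
    OnSide-s∙ a {w = w} (nf , Nw) = (λ f → nf (Fixed-s∙ a f)) , ≡.trans (N-s∙ a w) (≡.cong not Nw)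

    descend : ∀ a {w n} → OnSide J a true w → CosetLength≤ J w (suc n) → CosetLength≤ J (s a ∙ w) n
    descend a {w} (nf , Nw) (is , |is|≤1+n , g) with strong-exchange is (≡.trans (≡.sym (N-coset a g nf)) Nw)
    ... | js , |js|+1≡|is| , sₐ⟦is⟧≈⟦js⟧ =
      js , ≤-pred (≤-trans (≤-reflexive |js|+1≡|is|) |is|≤1+n) ,
      resp (∙-congˡ sₐ⟦is⟧≈⟦js⟧) (s∙-coset a g)

    near-side⇒N-tail : ∀ a {w is} → InSubgroup W s J (w ⁻¹ ∙ ⟦ a ∷ is ⟧) → OnSide J a false w →
                       N ⟦ is ⟧ (s a) ≡ true
    near-side⇒N-tail a {w} {is} g (nf , Nw) = not-injective (begin
      not (N ⟦ is ⟧ (s a))     ≡⟨ N-s∙ a ⟦ is ⟧ ⟨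
      N ⟦ a ∷ is ⟧ (s a)       ≡⟨ N-coset a g nf ⟨
      N w (s a)                ≡⟨ Nw ⟩
      false                    ∎)
      where open ≡.≡-Reasoning

    shorter-or-descent : ∀ {w n} → CosetLength≤ J w (suc n) → CosetLength≤ J w n ⊎ ∃ λ a → OnSide J a true w
    shorter-or-descent ([] , _ , g) = inj₁ ([] , z≤n , g)
    shorter-or-descent {w} (a ∷ is , s≤s |is|≤n , g) with InSubgroup? J (conj w (s a))
    ... | yes f = inj₁ (is , |is|≤n , resp fixed-cancel (mul f g))
      where
        open import Relation.Binary.Reasoning.Setoid setoid
        fixed-cancel : conj w (s a) ∙ (w ⁻¹ ∙ (s a ∙ ⟦ is ⟧)) ≈ w ⁻¹ ∙ ⟦ is ⟧
        fixed-cancel = begin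
          w ⁻¹ ∙ s a ∙ w ∙ (w ⁻¹ ∙ (s a ∙ ⟦ is ⟧))   ≈⟨ assoc _ _ _ ⟩
          w ⁻¹ ∙ s a ∙ (w ∙ (w ⁻¹ ∙ (s a ∙ ⟦ is ⟧))) ≈⟨ ∙-congˡ (\\-leftDividesˡ w _) ⟩
          w ⁻¹ ∙ s a ∙ (s a ∙ ⟦ is ⟧)                ≈⟨ assoc _ _ _ ⟩
          w ⁻¹ ∙ (s a ∙ (s a ∙ ⟦ is ⟧))              ≈⟨ ∙-congˡ (s-cancel a ⟦ is ⟧) ⟩
          w ⁻¹ ∙ ⟦ is ⟧                              ∎
    ... | no nf with N w (s a) in Nw
    ...   | true  = inj₂ (a , nf , Nw)
    ...   | false with strong-exchange is (near-side⇒N-tail a {is = is} g (nf , Nw))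
    ...     | js , |js|+1≡|is| , sₐ⟦is⟧≈⟦js⟧ =
      inj₁ (js , ≤-trans (n≤1+n _) (≤-trans (≤-reflexive |js|+1≡|is|) |is|≤n) ,
            resp (∙-congˡ sₐ⟦is⟧≈⟦js⟧) g)

module CutInvolutionFolding (C : CoxeterSystem) (r' : ℕ) (I : Fin (suc r') → Subset (CoxeterSystem.k C)) where
  open Bigraph C r' I
  open import Data.List.Membership.Propositional using () renaming (_∈_ to _∈ₗ_)

  module _ (ψ : CutInvolution) (R? : ∀ v → Dec (CutInvolution.R ψ v)) where
    open CutInvolution ψ

    fold⁺ : Vertex → Vertex
    fold⁺ v with R? v
    ... | yes _ = φ v
    ... | no  _ = v

    fold⁺-R : ∀ {v} → R v → fold⁺ v ≡ φ v
    fold⁺-R {v} r with R? v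
    ... | yes _ = ≡.refl
    ... | no ¬r = ⊥-elim (¬r r)

    fold⁺-¬R : ∀ {v} → ¬ R v → fold⁺ v ≡ v
    fold⁺-¬R {v} ¬r with R? v
    ... | yes r = ⊥-elim (¬r r)
    ... | no  _ = ≡.refl

    fold⁺-elim : (P : Vertex → Set) → ∀ v → (R v → P (φ v)) → (¬ R v → P v) → P (fold⁺ v)
    fold⁺-elim P v P-φ P-id with R? v
    ... | yes r  = P-φ r
    ... | no  ¬r = P-id ¬r

    fold⁺≐⁺ : ∀ K → (λ v → K (fold⁺ v)) ≐ (K ⁺)
    fold⁺≐⁺ K v with R? v
    ... | yes r  = (λ k → (λ _ → k) , λ ¬r → ⊥-elim (¬r r)) , λ (k , _) → k r
    ... | no  ¬r = (λ k → (λ r → ⊥-elim (¬r r)) , λ _ → k) , λ (_ , k) → k ¬r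

  module _ {A : Set} (ψ : A → CutInvolution) (R? : ∀ a v → Dec (CutInvolution.R (ψ a) v)) where

    foldAlong : List A → Vertex → Vertex
    foldAlong []       v = v
    foldAlong (a ∷ as) v = fold⁺ (ψ a) (R? a) (foldAlong as v)

    foldAlong-++ : ∀ as bs v → foldAlong (as ++ bs) v ≡ foldAlong as (foldAlong bs v)
    foldAlong-++ []       bs v = ≡.refl
    foldAlong-++ (a ∷ as) bs v = ≡.cong (fold⁺ (ψ a) (R? a)) (foldAlong-++ as bs v)

    FoldSeq-along : ∀ as {J J′} → (λ v → J (foldAlong as v)) ≐ J′ → FoldSeq J J′
    FoldSeq-along []       J≐J′ = stop J≐J′
    FoldSeq-along (a ∷ as) {J} J≐J′ = step (ψ a) (inj₁ (fold⁺≐⁺ (ψ a) (R? a) J)) (FoldSeq-along as J≐J′)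

    -- Q v n reads "v has length at most n".
    module Descent (Q : Vertex → ℕ → Set)
                   (Q-suc : ∀ {v n} → Q v n → Q v (suc n))
                   (Q-φ : ∀ a {v n} → CutInvolution.R (ψ a) v → Q v (suc n) → Q (CutInvolution.φ (ψ a) v) n)
                   where

      Q-fold⁺ : ∀ a v {n} → Q v n → Q (fold⁺ (ψ a) (R? a) v) n
      Q-fold⁺ a v {n} q = fold⁺-elim (ψ a) (R? a) (λ u → Q u n) v (λ r → Q-φ a r (Q-suc q)) (λ _ → q)

      sweep : ∀ as v {n} → Q v (suc n) →
              Q (foldAlong as v) n ⊎ (foldAlong as v ≡ v × ∀ {a} → a ∈ₗ as → ¬ CutInvolution.R (ψ a) v)
      sweep []       v q = inj₂ (≡.refl , λ ())
      sweep (a ∷ as) v {n} q with sweep as v q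
      ... | inj₁ q′ = inj₁ (Q-fold⁺ a _ q′)
      ... | inj₂ (unmoved , untouched) with R? a v
      ...   | yes r  = inj₁ (≡.subst (λ u → Q u n) (≡.sym moved) (Q-φ a r q))
        where
          moved : fold⁺ (ψ a) (R? a) (foldAlong as v) ≡ CutInvolution.φ (ψ a) v
          moved = ≡.trans (≡.cong (fold⁺ (ψ a) (R? a)) unmoved) (fold⁺-R (ψ a) (R? a) r)
      ...   | no  ¬r = inj₂ (≡.trans (≡.cong (fold⁺ (ψ a) (R? a)) unmoved) (fold⁺-¬R (ψ a) (R? a) ¬r)
                           , λ { (here ≡.refl) → ¬r ; (there a∈as) → untouched a∈as })

      module _ (as : List A) (complete : ∀ a → a ∈ₗ as)
               (shorter-or-R : ∀ {v n} → Q v (suc n) → Q v n ⊎ ∃ λ a → CutInvolution.R (ψ a) v) where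

        sweep-shortens : ∀ v {n} → Q v (suc n) → Q (foldAlong as v) n
        sweep-shortens v {n} q with sweep as v q
        ... | inj₁ q′ = q′
        ... | inj₂ (unmoved , untouched) with shorter-or-R q
        ...   | inj₁ q′      = ≡.subst (λ u → Q u n) (≡.sym unmoved) q′
        ...   | inj₂ (a , r) = ⊥-elim (untouched (complete a) r)

        sweeps-shorten : ∀ d v {n} → Q v (d + n) → Q (foldAlong (concat (replicate d as)) v) n
        sweeps-shorten zero    v q = q
        sweeps-shorten (suc d) v {n} q =
          ≡.subst (λ u → Q u n) (≡.sym (foldAlong-++ as (concat (replicate d as)) v))
            (sweep-shortens _ (sweeps-shorten d v (≡.subst (Q v) (≡.sym (+-suc d n)) q)))

module CoxeterBigraph (C : CoxeterSystem) (r' : ℕ) (I : Fin (suc r') → Subset (CoxeterSystem.k C)) where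
  open CoxeterSystem C
  open CoxeterGroup C
  open Bigraph C r' I
  open CutInvolutionFolding C r' I

  tag : Vertex → Fin (suc r')
  tag (left _)    = Fin.zero
  tag (right j _) = Fin.suc j

  rep : Vertex → Carrier
  rep (left w)    = w
  rep (right _ w) = w

  ∼-tag : ∀ {x y} → x ∼ y → tag x ≡ tag y
  ∼-tag {left _}    {left _}    _           = ≡.refl
  ∼-tag {right _ _} {right _ _} (≡.refl , _) = ≡.refl

  ∼-respects : {P : Subset k → Carrier → Set} →
               (∀ {J w w′} → InSubgroup W s J (w ⁻¹ ∙ w′) → P J w → P J w′) →
               ∀ {x y} → x ∼ y → P (I (tag x)) (rep x) → P (I (tag y)) (rep y)
  ∼-respects P-resp {left _}    {left _}    g            = P-resp g
  ∼-respects P-resp {right _ _} {right _ _} (≡.refl , g) = P-resp g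

  Fixedᵥ : Fin k → Vertex → Set
  Fixedᵥ a v = Fixed (I (tag v)) a (rep v)

  OnSideᵥ : Fin k → Bool → Vertex → Set
  OnSideᵥ a b v = OnSide (I (tag v)) a b (rep v)

  reflect : Fin k → Vertex → Vertex
  reflect a (left w)    = left (s a ∙ w)
  reflect a (right j w) = right j (s a ∙ w)

  tag-reflect : ∀ a v → tag (reflect a v) ≡ tag v
  tag-reflect a (left _)    = ≡.refl
  tag-reflect a (right _ _) = ≡.refl

  reflect-resp : ∀ a {x y} → x ∼ y → reflect a x ∼ reflect a y
  reflect-resp a {left _}    {left _}    g            = s∙-coset a g
  reflect-resp a {right _ _} {right _ _} (≡.refl , g) = ≡.refl , s∙-coset a g

  reflect-involutive : ∀ a v → reflect a (reflect a v) ∼ v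
  reflect-involutive a (left w)    = ≈⇒coset (s-cancel a w)
  reflect-involutive a (right j w) = ≡.refl , ≈⇒coset (s-cancel a w)

  reflect-Fixed : ∀ a v → Fixedᵥ a v → reflect a v ∼ v
  reflect-Fixed a (left w)    f = Fixed⇒coset a f
  reflect-Fixed a (right j w) f = ≡.refl , Fixed⇒coset a f

  reflect-OnSide : ∀ a {b} v → OnSideᵥ a b v → OnSideᵥ a (not b) (reflect a v)
  reflect-OnSide a (left w)    = OnSide-s∙ a
  reflect-OnSide a (right j w) = OnSide-s∙ a

  Intersect : Subset k → Carrier → Subset k → Carrier → Set
  Intersect J w J′ w′ = ∃ λ u → InSubgroup W s J (w ⁻¹ ∙ u) × InSubgroup W s J′ (w′ ⁻¹ ∙ u)

  Intersect-s∙ : ∀ a {J w J′ w′} → Intersect J w J′ w′ → Intersect J (s a ∙ w) J′ (s a ∙ w′)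
  Intersect-s∙ a (u , p , q) = s a ∙ u , s∙-coset a p , s∙-coset a q

  Intersect-s∙⁻ : ∀ a {J w J′ w′} → Intersect J (s a ∙ w) J′ (s a ∙ w′) → Intersect J w J′ w′
  Intersect-s∙⁻ a (u , p , q) = s a ∙ u , s∙-coset⁻ a p , s∙-coset⁻ a q

  reflect-Adj : ∀ a x y → (Adj x y → Adj (reflect a x) (reflect a y)) × (Adj (reflect a x) (reflect a y) → Adj x y)
  reflect-Adj a (left _)    (right _ _) = Intersect-s∙ a , Intersect-s∙⁻ a
  reflect-Adj a (right _ _) (left _)    = Intersect-s∙ a , Intersect-s∙⁻ a
  reflect-Adj a (left _)    (left _)    = (λ ()) , (λ ())
  reflect-Adj a (right _ _) (right _ _) = (λ ()) , (λ ())

  -- the ends of an edge share a representative u, so they lie on the same side of every wall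
  OnSide-no-edge : ∀ a x y → OnSideᵥ a false x → OnSideᵥ a true y → ¬ Adj x y
  OnSide-no-edge a (left _) (right _ _) Lx Ry (u , p , q)
    with () ← ≡.trans (≡.sym (proj₂ (OnSide-resp a p Lx))) (proj₂ (OnSide-resp a q Ry))
  OnSide-no-edge a (right _ _) (left _) Lx Ry (u , p , q)
    with () ← ≡.trans (≡.sym (proj₂ (OnSide-resp a q Lx))) (proj₂ (OnSide-resp a p Ry))

  Fixedᵥ? : ∀ a v → Dec (Fixedᵥ a v)
  Fixedᵥ? a v = InSubgroup? (I (tag v)) (conj (rep v) (s a))

  OnSideᵥ? : ∀ a b v → Dec (OnSideᵥ a b v)
  OnSideᵥ? a b v = ¬? (Fixedᵥ? a v) ×-dec (N (rep v) (s a) Bool.≟ b)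

  trichotomy : ∀ a v → OnSideᵥ a false v ⊎ (Fixedᵥ a v ⊎ OnSideᵥ a true v)
  trichotomy a v with Fixedᵥ? a v
  ... | yes f = inj₂ (inj₁ f)
  ... | no nf with N (rep v) (s a)
  ...   | false = inj₁ (nf , ≡.refl)
  ...   | true  = inj₂ (inj₂ (nf , ≡.refl))

  reflectionCut : Fin k → CutInvolution
  reflectionCut a = record
    { φ       = reflect a
    ; φ-resp  = reflect-resp a
    ; φ-invol = reflect-involutive a
    ; φ-adj   = reflect-Adj a
    ; L       = OnSideᵥ a false
    ; F       = Fixedᵥ a
    ; R       = OnSideᵥ a true
    ; L-resp  = ∼-respects (OnSide-resp a)
    ; F-resp  = ∼-respects (Fixed-resp a)
    ; R-resp  = ∼-respects (OnSide-resp a)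
    ; cover   = trichotomy a
    ; LF-disj = λ v ((nf , _) , f) → nf f
    ; LR-disj = λ v ((_ , Nf) , (_ , Nt)) → case ≡.trans (≡.sym Nf) Nt of λ ()
    ; FR-disj = λ v (f , (nf , _)) → nf f
    ; F-fixed = reflect-Fixed a
    ; φL⊆R    = reflect-OnSide a
    ; R⊆φL    = λ v Rv → reflect a v , reflect-OnSide a v Rv , reflect-involutive a v
    ; no-LR   = OnSide-no-edge a
    }

  Length≤ : Vertex → ℕ → Set
  Length≤ v = CosetLength≤ (I (tag v)) (rep v)

  Length≤-suc : ∀ {v n} → Length≤ v n → Length≤ v (suc n)
  Length≤-suc (is , |is|≤n , g) = is , ≤-trans |is|≤n (n≤1+n _) , g

  reflect-shortens : ∀ a {v n} → OnSideᵥ a true v → Length≤ v (suc n) → Length≤ (reflect a v) n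
  reflect-shortens a {left w}    = descend a
  reflect-shortens a {right j w} = descend a

  foldAll : List (Fin k) → Vertex → Vertex
  foldAll = foldAlong reflectionCut (λ a → OnSideᵥ? a true)

  tag-foldAll : ∀ as v → tag (foldAll as v) ≡ tag v
  tag-foldAll []       v = ≡.refl
  tag-foldAll (a ∷ as) v =
    fold⁺-elim (reflectionCut a) (OnSideᵥ? a true) (λ u → tag u ≡ tag v) (foldAll as v)
      (λ _ → ≡.trans (tag-reflect a (foldAll as v)) (tag-foldAll as v)) (λ _ → tag-foldAll as v)

  rounds : ℕ → List (Fin k)
  rounds d = concat (replicate d (allFin k))

  rounds-shorten : ∀ d v {n} → Length≤ v (d + n) → Length≤ (foldAll (rounds d) v) n
  rounds-shorten = sweeps-shorten (allFin k) ∈-allFin (λ {v} → shorter-or-descent {I (tag v)} {rep v})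
    where open Descent reflectionCut (λ a → OnSideᵥ? a true) Length≤ Length≤-suc reflect-shortens

  Length≤0⇒∼ε : ∀ v → tag v ≡ Fin.zero → Length≤ v 0 → v ∼ left ε
  Length≤0⇒∼ε (left w) _ ([] , _ , g) = g

  wordLengthBound : ℕ
  wordLengthBound = proj₁ word-length-bound

  Length≤-bound : ∀ w → Length≤ (left w) (wordLengthBound + 0)
  Length≤-bound w =
    let (is , |is|≤ , ⟦is⟧≈w) = proj₂ word-length-bound w
    in  is , ≤-trans |is|≤ (≤-reflexive (≡.sym (+-identityʳ wordLengthBound))) , ≈⇒coset (sym ⟦is⟧≈w)

  left-foldAll-rounds : ∀ w → foldAll (rounds wordLengthBound) (left w) ∼ left ε
  left-foldAll-rounds w = Length≤0⇒∼ε _ (tag-foldAll (rounds wordLengthBound) (left w))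
                            (rounds-shorten wordLengthBound (left w) (Length≤-bound w))

  right-foldAll≁left : ∀ as j w → ¬ foldAll as (right j w) ∼ left ε
  right-foldAll≁left as j w e = case ≡.trans (≡.sym (tag-foldAll as (right j w))) (∼-tag e) of λ ()

corollary3p4 : (C : CoxeterSystem) (r' : ℕ)
               (I : Fin (suc r') → Subset (CoxeterSystem.k C)) →
               Bigraph.HasPercolatingSeqLeft C r' I
corollary3p4 C r' I =
  left ε , tt , FoldSeq-along reflectionCut (λ a → OnSideᵥ? a true) (rounds wordLengthBound) preimage-is-left-part
  where
    open CoxeterSystem C using (ε)
    open Bigraph C r' I
    open CutInvolutionFolding C r' I
    open CoxeterBigraph C r' I

    preimage-is-left-part : (λ v → foldAll (rounds wordLengthBound) v ∼ left ε) ≐ InLeftPart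
    preimage-is-left-part (left w)    = (λ _ → tt) , (λ _ → left-foldAll-rounds w)
    preimage-is-left-part (right j w) =
      (λ e → ⊥-elim (right-foldAll≁left (rounds wordLengthBound) j w e)) , (λ ())
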